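{- Let $\mathcal F$ be a Fano plane. (i) Let $P\mapsto\alpha_P$ and $P\mapsto\beta_P$ be oriented maps $\mathcal F\to V_{\mathcal F}^\ast$, and define $\Delta:V_{\mathcal F}\times V_{\mathcal F}\to\mathbb Z_2$ by $\Delta(P,Q)=\alpha_P(Q)+\beta_P(Q)$ for $(P,Q)\in\mathcal F\times\mathcal F$ and $\Delta(P,Q)=0$ if $P=0$ or $Q=0$. Then $\Delta$ is symmetric, bilinear, and $\Delta(P,P)=0$ for all $P\in V_{\mathcal F}$. (ii) Let $P\mapsto\alpha_P$ be an oriented map and let $\Delta:V_{\mathcal F}\times V_{\mathcal F}\to\mathbb Z_2$ be symmetric, bilinear with $\Delta(P,P)=0$ for all $P\in\mathcal F$. Define $\beta_P(Q)=\Delta(P,Q)+\alpha_P(Q)$ for all $P\in\mathcal F$, $Q\in V_{\mathcal F}$. Then $P\mapsto\beta_P$ is an oriented map.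
   Context: A Fano plane is a set $\mathcal F$ of seven points together with a set of seven $3$-element subsets of $\mathcal F$ called lines, such that any two distinct points lie in a unique line and any two distinct lines meet in a unique point. The Fano cube is $V_{\mathcal F}=\mathcal F\cup\{0\}$ with the unique $\mathbb Z_2$-vector space structure with zero $0$ such that for distinct $P,Q\in\mathcal F$, $P+Q$ is the third point of the line through $P$ and $Q$; $V_{\mathcal F}^\ast$ is its dual. An oriented map is a map $\alpha:\mathcal F\to V_{\mathcal F}^\ast$, $P\mapsto\alpha_P$, such that (i) $\alpha_P(P)=1$ for all $P\in\mathcal F$, and (ii) $\alpha_P(Q)+\alpha_Q(P)=1$ for all $P\neq Q$ in $\mathcal F$. -}

module Defs where

open import Data.Bool using (Bool; true; false; _xor_)
open import Data.Fin using (Fin)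
open import Data.Fin.Subset using (Subset; _∈_; ∣_∣)
open import Data.Maybe using (Maybe; just; nothing)
open import Data.Nat using (ℕ)
open import Data.Product using (_×_; ∃!)
open import Function.Definitions using (Injective)
open import Relation.Binary.PropositionalEquality using (_≡_; _≢_)

-- The field Z₂ is modelled by Bool (false = 0, true = 1, _xor_ = addition).

record FanoPlane : Set where
  field
    Line          : Fin 7 → Subset 7
    line-size     : ∀ i → ∣ Line i ∣ ≡ 3
    lines-distinct : Injective _≡_ _≡_ Line
    two-points    : ∀ (P Q : Fin 7) → P ≢ Q →
                    ∃! _≡_ (λ i → (P ∈ Line i) × (Q ∈ Line i))
    two-lines     : ∀ (i j : Fin 7) → i ≢ j →
                    ∃! _≡_ (λ P → (P ∈ Line i) × (P ∈ Line j))

-- The Fano cube V_F = F ∪ {0}: nothing is the zero vector, just P the point P.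
V : Set
V = Maybe (Fin 7)

module _ (F : FanoPlane) where
  open FanoPlane F

  -- The graph of the vector addition of V_F:  x + y ≡ z  iff  AddRel x y z.
  -- 0 + y = y, x + 0 = x, P + P = 0, and for distinct points P, Q,
  -- P + Q is the third point of the line through P and Q.
  data AddRel : V → V → V → Set where
    zeroˡ : ∀ y → AddRel nothing y y
    zeroʳ : ∀ x → AddRel x nothing x
    diag  : ∀ P → AddRel (just P) (just P) nothing
    third : ∀ P Q R (i : Fin 7) → P ≢ Q → R ≢ P → R ≢ Q →
            P ∈ Line i → Q ∈ Line i → R ∈ Line i →
            AddRel (just P) (just Q) (just R)

  IsLinear : (V → Bool) → Set
  IsLinear f = (f nothing ≡ false)
             × (∀ x y z → AddRel x y z → f z ≡ f x xor f y)

  IsOriented : (Fin 7 → V → Bool) → Set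
  IsOriented α = (∀ P → IsLinear (α P))
               × (∀ P → α P (just P) ≡ true)
               × (∀ P Q → P ≢ Q → α P (just Q) xor α Q (just P) ≡ true)

  IsSymmetric : (V → V → Bool) → Set
  IsSymmetric Δ = ∀ x y → Δ x y ≡ Δ y x

  IsBilinear : (V → V → Bool) → Set
  IsBilinear Δ = (∀ x → IsLinear (λ y → Δ x y)) × (∀ y → IsLinear (λ x → Δ x y))

  diffForm : (α β : Fin 7 → V → Bool) → V → V → Bool
  diffForm α β nothing  _        = false
  diffForm α β (just P) nothing  = false
  diffForm α β (just P) (just Q) = α P (just Q) xor β P (just Q)

{-# OPTIONS --safe #-}
-- Over Z₂, axiom (ii) of an oriented map says that its skew part α_P(Q) + α_Q(P)
-- is the constant 1 off the diagonal. Two oriented maps therefore have the same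
-- skew part, so their difference is symmetric; conversely, adding a symmetric form
-- leaves the skew part unchanged. Linearity and the diagonal values are inherited
-- termwise, since sums of functionals are functionals.
module Submission where

open import Defs
open import Algebra.Bundles using (CommutativeRing)
open import Data.Bool using (Bool; true; false; _xor_)
open import Data.Bool.Properties using (xor-∧-commutativeRing; xor-same)
open import Data.Fin using (Fin)
open import Data.Fin.Properties using (_≟_)
open import Data.Maybe using (just; nothing)
open import Data.Product using (_×_; _,_; proj₁; proj₂)
open import Relation.Nullary using (yes; no)
open import Relation.Binary.PropositionalEquality
  using (_≡_; _≢_; refl; sym; trans; cong; cong₂; module ≡-Reasoning)

open import Algebra.Properties.CommutativeSemigroup
  (CommutativeRing.+-commutativeSemigroup xor-∧-commutativeRing) using (interchange)

xor≡false⇒≡ : ∀ {a b} → a xor b ≡ false → a ≡ b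
xor≡false⇒≡ {false} {false} _ = refl
xor≡false⇒≡ {true}  {true}  _ = refl

module _ (F : FanoPlane) where

  module Oriented {α : Fin 7 → V → Bool} (α-or : IsOriented F α) where
    linear : ∀ P → IsLinear F (α P)
    linear = proj₁ α-or

    self : ∀ P → α P (just P) ≡ true
    self = proj₁ (proj₂ α-or)

    skew : ∀ P Q → P ≢ Q → α P (just Q) xor α Q (just P) ≡ true
    skew = proj₂ (proj₂ α-or)

  IsLinear-xor : ∀ {f g : V → Bool} → IsLinear F f → IsLinear F g →
                 IsLinear F (λ y → f y xor g y)
  IsLinear-xor {f} {g} (f0 , f+) (g0 , g+) =
    cong₂ _xor_ f0 g0 ,
    λ x y z x+y≡z → trans (cong₂ _xor_ (f+ x y z x+y≡z) (g+ x y z x+y≡z))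
                          (interchange (f x) (f y) (g x) (g y))

  IsLinear-resp : ∀ {f g : V → Bool} → (∀ x → f x ≡ g x) → IsLinear F f → IsLinear F g
  IsLinear-resp {f} {g} f≗g (f0 , f+) =
    trans (sym (f≗g nothing)) f0 ,
    λ x y z x+y≡z → trans (sym (f≗g z))
                          (trans (f+ x y z x+y≡z) (cong₂ _xor_ (f≗g x) (f≗g y)))

  symmetric∧linearʳ⇒bilinear : ∀ {Δ : V → V → Bool} → IsSymmetric F Δ →
                               (∀ x → IsLinear F (Δ x)) → IsBilinear F Δ
  symmetric∧linearʳ⇒bilinear {Δ} Δ-sym Δ-lin =
    Δ-lin , λ y → IsLinear-resp (Δ-sym y) (Δ-lin y)

  module _ {α β : Fin 7 → V → Bool} (α-or : IsOriented F α) (β-or : IsOriented F β) where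
    private
      open ≡-Reasoning
      module α = Oriented α-or
      module β = Oriented β-or

      Δ : V → V → Bool
      Δ = diffForm F α β

    diffForm-row : ∀ P y → Δ (just P) y ≡ α P y xor β P y
    diffForm-row P nothing  = sym (cong₂ _xor_ (proj₁ (α.linear P)) (proj₁ (β.linear P)))
    diffForm-row P (just Q) = refl

    diffForm-symmetric : IsSymmetric F Δ
    diffForm-symmetric nothing  nothing  = refl
    diffForm-symmetric nothing  (just Q) = refl
    diffForm-symmetric (just P) nothing  = refl
    diffForm-symmetric (just P) (just Q) with P ≟ Q
    ... | yes refl = refl
    ... | no P≢Q   = xor≡false⇒≡ (begin
      (α P (just Q) xor β P (just Q)) xor (α Q (just P) xor β Q (just P))
        ≡⟨ interchange (α P (just Q)) _ _ _ ⟩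
      (α P (just Q) xor α Q (just P)) xor (β P (just Q) xor β Q (just P))
        ≡⟨ cong₂ _xor_ (α.skew P Q P≢Q) (β.skew P Q P≢Q) ⟩
      false ∎)

    diffForm-bilinear : IsBilinear F Δ
    diffForm-bilinear = symmetric∧linearʳ⇒bilinear diffForm-symmetric Δ-lin
      where
      Δ-lin : ∀ x → IsLinear F (Δ x)
      Δ-lin nothing  = refl , λ _ _ _ _ → refl
      Δ-lin (just P) = IsLinear-resp (λ y → sym (diffForm-row P y))
                         (IsLinear-xor (α.linear P) (β.linear P))

    diffForm-alternating : ∀ x → Δ x x ≡ false
    diffForm-alternating nothing  = refl
    diffForm-alternating (just P) = cong₂ _xor_ (α.self P) (β.self P)

  IsOriented-twist : ∀ {α : Fin 7 → V → Bool} {Δ : V → V → Bool} → IsOriented F α →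
                     IsSymmetric F Δ → (∀ x → IsLinear F (Δ x)) →
                     (∀ P → Δ (just P) (just P) ≡ false) →
                     IsOriented F (λ P Q → Δ (just P) Q xor α P Q)
  IsOriented-twist {α} {Δ} α-or Δ-sym Δ-lin Δ-alt =
    (λ P → IsLinear-xor (Δ-lin (just P)) (α.linear P)) ,
    (λ P → cong₂ _xor_ (Δ-alt P) (α.self P)) ,
    twisted-skew
    where
    open ≡-Reasoning
    module α = Oriented α-or

    twisted-skew : ∀ P Q → P ≢ Q →
      (Δ (just P) (just Q) xor α P (just Q)) xor (Δ (just Q) (just P) xor α Q (just P)) ≡ true
    twisted-skew P Q P≢Q = begin
      (Δ (just P) (just Q) xor α P (just Q)) xor (Δ (just Q) (just P) xor α Q (just P))
        ≡⟨ interchange (Δ (just P) (just Q)) _ _ _ ⟩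
      (Δ (just P) (just Q) xor Δ (just Q) (just P)) xor (α P (just Q) xor α Q (just P))
        ≡⟨ cong₂ _xor_ (trans (cong (Δ (just P) (just Q) xor_) (Δ-sym (just Q) (just P)))
                              (xor-same (Δ (just P) (just Q))))
                       (α.skew P Q P≢Q) ⟩
      true ∎

proposition3p7 : (F : FanoPlane) →
    ((α β : Fin 7 → V → Bool) → IsOriented F α → IsOriented F β →
      IsSymmetric F (diffForm F α β) × IsBilinear F (diffForm F α β)
        × (∀ x → diffForm F α β x x ≡ false))
    ×
    ((α : Fin 7 → V → Bool) → (Δ : V → V → Bool) → IsOriented F α →
      IsSymmetric F Δ → IsBilinear F Δ → (∀ P → Δ (just P) (just P) ≡ false) →
      IsOriented F (λ P Q → Δ (just P) Q xor α P Q))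
proposition3p7 F =
  (λ α β α-or β-or → diffForm-symmetric F α-or β-or ,
                     diffForm-bilinear F α-or β-or ,
                     diffForm-alternating F α-or β-or) ,
  (λ α Δ α-or Δ-sym Δ-bilinear Δ-alt →
     IsOriented-twist F α-or Δ-sym (proj₁ Δ-bilinear) Δ-alt)
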